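{- Let $G$ be a nontrivial finite group of order $n$ in which every nonidentity element has prime order. Then $\lambda(\Gamma_G)=2(n-1)$ if $n$ is a prime, and $\lambda(\Gamma_G)=n$ otherwise.
   Context: The (undirected) power graph $\Gamma_G$ of a finite group $G$ has vertex set $G$, two distinct elements being adjacent if one is a power of the other. An $L(2,1)$-labeling of a graph $\Gamma$ is a function $f:V(\Gamma)\to\mathbb{Z}_{\ge 0}$ such that $|f(u)-f(v)|\ge 2$ for adjacent $u,v$ and $|f(u)-f(v)|\ge 1$ for $u,v$ at distance two; its span is $\max f-\min f$, and $\lambda(\Gamma)$ is the minimum span over all $L(2,1)$-labelings of $\Gamma$. -}

module Defs where

open import Data.Nat using (ℕ; zero; suc; _+_; _*_; _∸_; _<_; _≤_; _⊔_; _⊓_)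
open import Data.Nat.Primality using (Prime)
open import Data.Fin using (Fin)
open import Data.List using (List; foldr; map; allFin)
open import Data.Product using (Σ; ∃; _×_; _,_)
open import Data.Sum using (_⊎_)
open import Relation.Nullary using (¬_)
open import Relation.Binary.PropositionalEquality using (_≡_; _≢_)
open import Algebra.Structures using (IsGroup)

-- A finite group of order n, presented on the carrier Fin n
-- (every group of order n is isomorphic to one of these).
record FinGroup (n : ℕ) : Set where
  field
    _∙_     : Fin n → Fin n → Fin n
    ε       : Fin n
    _⁻¹     : Fin n → Fin n
    isGroup : IsGroup _≡_ _∙_ ε _⁻¹

module _ {n : ℕ} (G : FinGroup n) where
  open FinGroup G

  pow : Fin n → ℕ → Fin n
  pow g zero    = ε
  pow g (suc k) = g ∙ pow g k

  HasOrder : Fin n → ℕ → Set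
  HasOrder g p = (0 < p) × (pow g p ≡ ε) × (∀ k → 0 < k → k < p → pow g k ≢ ε)

  HasPrimeOrder : Fin n → Set
  HasPrimeOrder g = ∃ λ p → Prime p × HasOrder g p

  IsPowerOf : Fin n → Fin n → Set
  IsPowerOf u v = ∃ λ k → u ≡ pow v k

  Adj : Fin n → Fin n → Set
  Adj u v = u ≢ v × (IsPowerOf u v ⊎ IsPowerOf v u)

  Dist2 : Fin n → Fin n → Set
  Dist2 u v = u ≢ v × ¬ Adj u v × (∃ λ w → Adj u w × Adj w v)

  IsL21 : (Fin n → ℕ) → Set
  IsL21 f = (∀ u v → Adj u v → (f u + 2 ≤ f v) ⊎ (f v + 2 ≤ f u))
          × (∀ u v → Dist2 u v → (f u + 1 ≤ f v) ⊎ (f v + 1 ≤ f u))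

  maxLabel : (Fin n → ℕ) → ℕ
  maxLabel f = foldr _⊔_ 0 (map f (allFin n))

  -- minimum of the labels (for n ≥ 1 this is the true minimum, as maxLabel is attained)
  minLabel : (Fin n → ℕ) → ℕ
  minLabel f = foldr _⊓_ (maxLabel f) (map f (allFin n))

  span : (Fin n → ℕ) → ℕ
  span f = maxLabel f ∸ minLabel f

  LambdaIs : ℕ → Set
  LambdaIs m = (∃ λ f → IsL21 f × span f ≡ m) × (∀ f → IsL21 f → m ≤ span f)

-- If n is prime, Lagrange's theorem makes G cyclic, so Γ_G is complete: labels are pairwise at
-- least 2 apart, forcing span ≥ 2(n − 1), which v ↦ 2v attains.
-- If n is composite, each nonidentity element has prime order p with p ∣ n and p ≠ n, so
-- p ≤ ⌊n/2⌋. Nonidentity elements are adjacent exactly when they generate the same cyclic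
-- subgroup, so Γ_G is the identity joined to disjoint cliques of size p − 1, and any two
-- vertices are at distance at most 2. Hence all labels differ, and the values next to the
-- identity's label are not labels, so one of them is a gap inside the range: span ≥ n.
-- Conversely, rank the nonidentity elements 0, …, n − 2 clique by clique and send rank i to 2i
-- if i < ⌊n/2⌋ and to 2(i − ⌊n/2⌋) + 1 otherwise: ranks in one clique differ by at most
-- ⌊n/2⌋ − 2, so their images differ by at least 2. Shifting these by 2 and labelling the
-- identity 0 gives span n.
module Submission where

open import Defs
open import Data.Nat using (ℕ; _<_; _*_; _∸_)
open import Data.Nat.Primality using (Prime)
open import Data.Fin using (Fin)
open import Data.Product using (_×_)
open import Relation.Nullary using (¬_)
open import Relation.Binary.PropositionalEquality using (_≢_)

open import Level using (0ℓ)
open import Function using (_∘_)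
open import Function.Definitions using (Injective)
open import Data.Empty using (⊥)
open import Data.Bool.Base using (if_then_else_)
open import Data.Product using (∃; _,_; proj₁; proj₂)
open import Data.Sum using (_⊎_; inj₁; inj₂)
import Data.Sum
open import Relation.Nullary using (Dec; yes; no; does; contradiction; ¬?; _×-dec_)
open import Relation.Unary using (Pred; Decidable)
open import Relation.Binary.Definitions using (tri<; tri≈; tri>)
open import Relation.Binary.PropositionalEquality
  using (_≡_; refl; sym; trans; cong; cong₂; subst; subst₂; module ≡-Reasoning)

open import Data.Nat.Base
  using ( zero; suc; _+_; _≤_; z≤n; s≤s; z<s; _⊔_; _⊓_; pred; _%_; _/_; ⌊_/2⌋; ⌈_/2⌉
        ; NonZero; >-nonZero; nonTrivial⇒n>1)
open import Data.Nat using (_<?_)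
open import Data.Nat.Properties hiding (_≟_; 0≢1+n)
open import Data.Nat.Solver using (module +-*-Solver)
open +-*-Solver using (solve; _:+_; _:*_; _:=_; con)
open import Data.Nat.DivMod using (m≡m%n+[m/n]*n; m%n<n; _mod_)
open import Data.Nat.Divisibility using (_∣_; divides; _∣0; ∣-refl; ∣m∣n⇒∣m+n)
open import Data.Nat.Primality using (prime⇒nonTrivial; prime⇒irreducible; ¬prime[1])
open import Data.Nat.Coprimality using (coprime-Bézout; prime⇒coprime)
import Data.Nat.Coprimality as Coprime
open import Data.Nat.GCD using (module Bézout)

open import Data.Fin.Base using (zero; suc; toℕ; fromℕ<; combine; punchOut)
open import Data.Fin.Properties
  using ( _≟_; 0≢1+n; any?; toℕ-injective; toℕ<n; toℕ-fromℕ<; fromℕ<-injective; punchOut-injective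
        ; injective⇒≤; toℕ-combine; combine-monoˡ-<; combine-injectiveʳ)

open import Data.List.Base using (applyUpTo; map; allFin)
open import Data.List.Properties using (foldr-preservesᵒ; foldr-preservesᵇ)
import Data.List.Relation.Unary.All as All
open import Data.List.Extrema.Nat using (argmin; f[argmin]≤v⁺; argmin-sel)
open import Data.List.Membership.Propositional using (_∈_; lose)
open import Data.List.Membership.Propositional.Properties
  using (∈-applyUpTo⁺; ∈-applyUpTo⁻; ∈-map⁺; ∈-map⁻; ∈-allFin)

open import Algebra.Structures using (IsGroup)
open import Algebra.Bundles using (Group)
open import Algebra.Properties.CommutativeMonoid.Sum +-0-commutativeMonoid
  using (sum-syntax; ∑-comm; ∑-distrib-+; sum-cong-≗)

𝟙 : ∀ {P : Set} → Dec P → ℕ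
𝟙 P? = if does P? then 1 else 0

𝟙-yes : ∀ {P : Set} (P? : Dec P) → P → 𝟙 P? ≡ 1
𝟙-yes (yes _) _ = refl
𝟙-yes (no ¬p) p = contradiction p ¬p

𝟙-no : ∀ {P : Set} (P? : Dec P) → ¬ P → 𝟙 P? ≡ 0
𝟙-no (yes p) ¬p = contradiction p ¬p
𝟙-no (no _)  _  = refl

𝟙-≤1 : ∀ {P : Set} (P? : Dec P) → 𝟙 P? ≤ 1
𝟙-≤1 (yes _) = ≤-refl
𝟙-≤1 (no _)  = z≤n

𝟙-mono : ∀ {P Q : Set} (P? : Dec P) (Q? : Dec Q) → (P → Q) → 𝟙 P? ≤ 𝟙 Q?
𝟙-mono (yes p) Q? P⇒Q = ≤-reflexive (sym (𝟙-yes Q? (P⇒Q p)))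
𝟙-mono (no _)  _  _   = z≤n

𝟙-cong : ∀ {P Q : Set} (P? : Dec P) (Q? : Dec Q) → (P → Q) → (Q → P) → 𝟙 P? ≡ 𝟙 Q?
𝟙-cong P? Q? P⇒Q Q⇒P = ≤-antisym (𝟙-mono P? Q? P⇒Q) (𝟙-mono Q? P? Q⇒P)

𝟙-⊎ : ∀ {P Q R : Set} (P? : Dec P) (Q? : Dec Q) (R? : Dec R) → (P → Q ⊎ R) → 𝟙 P? ≤ 𝟙 Q? + 𝟙 R?
𝟙-⊎ (no _)  _  _  _ = z≤n
𝟙-⊎ (yes p) Q? R? P⇒Q⊎R with P⇒Q⊎R p
... | inj₁ q = ≤-trans (≤-reflexive (sym (𝟙-yes Q? q))) (m≤m+n _ _)
... | inj₂ r = ≤-trans (≤-reflexive (sym (𝟙-yes R? r))) (m≤n+m _ _)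

∑-mono-≤ : ∀ {n} {f g : Fin n → ℕ} → (∀ x → f x ≤ g x) → ∑[ x < n ] f x ≤ ∑[ x < n ] g x
∑-mono-≤ {zero}  _   = z≤n
∑-mono-≤ {suc n} f≤g = +-mono-≤ (f≤g zero) (∑-mono-≤ (f≤g ∘ suc))

∑-mono-< : ∀ {n} {f g : Fin n → ℕ} → (∀ x → f x ≤ g x) → ∀ x → f x < g x →
           ∑[ x < n ] f x < ∑[ x < n ] g x
∑-mono-< f≤g zero    fx<gx = +-mono-<-≤ fx<gx (∑-mono-≤ (f≤g ∘ suc))
∑-mono-< f≤g (suc x) fx<gx = +-mono-≤-< (f≤g zero) (∑-mono-< (f≤g ∘ suc) x fx<gx)

∑-ones : ∀ n → ∑[ x < n ] 1 ≡ n
∑-ones zero    = refl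
∑-ones (suc n) = cong suc (∑-ones n)

∑-zeros : ∀ {n} {f : Fin n → ℕ} → (∀ x → f x ≡ 0) → ∑[ x < n ] f x ≡ 0
∑-zeros {zero}  _  = refl
∑-zeros {suc n} f0 = cong₂ _+_ (f0 zero) (∑-zeros (f0 ∘ suc))

∑-∣ : ∀ {n d} {f : Fin n → ℕ} → (∀ x → d ∣ f x) → d ∣ ∑[ x < n ] f x
∑-∣ {zero}  _    = _ ∣0
∑-∣ {suc n} d∣fx = ∣m∣n⇒∣m+n (d∣fx zero) (∑-∣ (d∣fx ∘ suc))

∑-𝟙-≟ : ∀ {n} (y : Fin n) → ∑[ x < n ] 𝟙 (x ≟ y) ≡ 1
∑-𝟙-≟ {suc n} zero    = cong suc (∑-zero n)
  where
  ∑-zero : ∀ n → ∑[ x < n ] 𝟙 (suc x ≟ zero) ≡ 0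
  ∑-zero zero    = refl
  ∑-zero (suc n) = ∑-zero n
∑-𝟙-≟ {suc n} (suc y) = ∑-𝟙-≟ y

∑-𝟙-≟ˡ : ∀ {n} (y : Fin n) → ∑[ x < n ] 𝟙 (y ≟ x) ≡ 1
∑-𝟙-≟ˡ y = trans (sum-cong-≗ (λ x → 𝟙-cong (y ≟ x) (x ≟ y) sym sym)) (∑-𝟙-≟ y)

term≤∑ : ∀ {n} (f : Fin n → ℕ) x → f x ≤ ∑[ x < n ] f x
term≤∑ f zero    = m≤m+n _ _
term≤∑ f (suc x) = ≤-trans (term≤∑ (f ∘ suc) x) (m≤n+m _ (f zero))

count : ∀ {n} {P : Pred (Fin n) 0ℓ} → Decidable P → ℕ
count {n} P? = ∑[ x < n ] 𝟙 (P? x)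

module _ {n : ℕ} {P : Pred (Fin n) 0ℓ} (P? : Decidable P) where

  count-mono-< : ∀ {Q} (Q? : Decidable Q) → (∀ {x} → P x → Q x) → ∀ x → ¬ P x → Q x → count P? < count Q?
  count-mono-< Q? P⊆Q x ¬px qx = ∑-mono-< (λ x → 𝟙-mono (P? x) (Q? x) P⊆Q) x
    (subst₂ _<_ (sym (𝟙-no (P? x) ¬px)) (sym (𝟙-yes (Q? x) qx)) ≤-refl)

  count-⊎ : ∀ {Q R} (Q? : Decidable Q) (R? : Decidable R) → (∀ {x} → P x → Q x ⊎ R x) →
            count P? ≤ count Q? + count R?
  count-⊎ Q? R? P⊆Q∪R = ≤-trans (∑-mono-≤ (λ x → 𝟙-⊎ (P? x) (Q? x) (R? x) P⊆Q∪R))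
                                (≤-reflexive (∑-distrib-+ (λ x → 𝟙 (Q? x)) (λ x → 𝟙 (R? x))))

  count<n : ∀ x → ¬ P x → count P? < n
  count<n x ¬px = subst (count P? <_) (∑-ones n)
    (∑-mono-< (λ x → 𝟙-≤1 (P? x)) x (≤-reflexive (cong suc (𝟙-no (P? x) ¬px))))

  count-empty : (∀ x → ¬ P x) → count P? ≡ 0
  count-empty ∅ = ∑-zeros (λ x → 𝟙-no (P? x) (∅ x))

∑-𝟙-image : ∀ {n m} (h : Fin m → Fin n) → ∑[ x < n ] ∑[ k < m ] 𝟙 (x ≟ h k) ≡ m
∑-𝟙-image {n} {m} h = begin
  ∑[ x < n ] ∑[ k < m ] 𝟙 (x ≟ h k)  ≡⟨ ∑-comm (λ x k → 𝟙 (x ≟ h k)) ⟩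
  ∑[ k < m ] ∑[ x < n ] 𝟙 (x ≟ h k)  ≡⟨ sum-cong-≗ (λ k → ∑-𝟙-≟ (h k)) ⟩
  ∑[ k < m ] 1                       ≡⟨ ∑-ones m ⟩
  m                                  ∎
  where open ≡-Reasoning

module _ {n m : ℕ} {P : Pred (Fin n) 0ℓ} (P? : Decidable P) (h : Fin m → Fin n) where

  count-image-≤ : (∀ {x} → P x → ∃ λ k → x ≡ h k) → count P? ≤ m
  count-image-≤ P⊆im = ≤-trans (∑-mono-≤ one-preimage-≤) (≤-reflexive (∑-𝟙-image h))
    where
    one-preimage-≤ : ∀ x → 𝟙 (P? x) ≤ ∑[ k < m ] 𝟙 (x ≟ h k)
    one-preimage-≤ x with P? x
    ... | no _   = z≤n
    ... | yes px with k , x≡hk ← P⊆im px = ≤-trans (≤-reflexive (sym (𝟙-yes (x ≟ h k) x≡hk))) (term≤∑ _ k)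

  count-image : Injective _≡_ _≡_ h → (∀ {x} → P x → ∃ λ k → x ≡ h k) → (∀ k → P (h k)) →
                count P? ≡ m
  count-image h-inj P⊆im im⊆P = trans (sum-cong-≗ one-preimage) (∑-𝟙-image h)
    where
    one-preimage : ∀ x → 𝟙 (P? x) ≡ ∑[ k < m ] 𝟙 (x ≟ h k)
    one-preimage x with P? x
    ... | no ¬px = sym (∑-zeros (λ k → 𝟙-no (x ≟ h k) λ { refl → ¬px (im⊆P k) }))
    ... | yes px with k₀ , refl ← P⊆im px =
      sym (trans (sum-cong-≗ (λ k → 𝟙-cong (h k₀ ≟ h k) (k₀ ≟ k) h-inj (cong h))) (∑-𝟙-≟ˡ k₀))

count-fibres : ∀ {n m} (f : Fin n → Fin m) → ∑[ c < m ] count (λ x → f x ≟ c) ≡ n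
count-fibres {n} {m} f = begin
  ∑[ c < m ] ∑[ x < n ] 𝟙 (f x ≟ c)  ≡⟨ ∑-comm (λ c x → 𝟙 (f x ≟ c)) ⟩
  ∑[ x < n ] ∑[ c < m ] 𝟙 (f x ≟ c)  ≡⟨ sum-cong-≗ (λ x → ∑-𝟙-≟ˡ (f x)) ⟩
  ∑[ x < n ] 1                       ≡⟨ ∑-ones n ⟩
  n                                  ∎
  where open ≡-Reasoning

leastOf : ∀ {n} → (ℕ → Fin n) → ℕ → Fin n
leastOf f m = argmin toℕ (f 0) (applyUpTo f m)

leastOf-≤ : ∀ {n} (f : ℕ → Fin n) {m i} → i < m → toℕ (leastOf f m) ≤ toℕ (f i)
leastOf-≤ f {m} i<m = f[argmin]≤v⁺ {f = toℕ} (f 0) (applyUpTo f m) (inj₂ (lose (∈-applyUpTo⁺ f i<m) ≤-refl))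

leastOf-∈ : ∀ {n} (f : ℕ → Fin n) {m} → 0 < m → ∃ λ i → i < m × leastOf f m ≡ f i
leastOf-∈ f {m} 0<m with argmin-sel toℕ (f 0) (applyUpTo f m)
... | inj₁ least≡f0 = 0 , 0<m , least≡f0
... | inj₂ least∈   = ∈-applyUpTo⁻ f least∈

combine-monoʳ-< : ∀ {m n} (i : Fin m) {k l : Fin n} → toℕ k < toℕ l → toℕ (combine i k) < toℕ (combine i l)
combine-monoʳ-< {n = n} i {k} {l} k<l =
  subst₂ _<_ (sym (toℕ-combine i k)) (sym (toℕ-combine i l)) (+-monoʳ-< (n * toℕ i) k<l)

combine-<-lex : ∀ {m n} {i j : Fin m} {k l : Fin n} → toℕ (combine i k) < toℕ (combine j l) →
                toℕ i < toℕ j ⊎ (i ≡ j × toℕ k < toℕ l)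
combine-<-lex {n = n} {i} {j} {k} {l} cik<cjl with <-cmp (toℕ i) (toℕ j)
... | tri< i<j _ _ = inj₁ i<j
... | tri> _ _ j<i = contradiction (combine-monoˡ-< l k j<i) (<-asym cik<cjl)
... | tri≈ _ i≡j _ with refl ← toℕ-injective i≡j =
  inj₂ (refl , +-cancelˡ-< (n * toℕ i) _ _ (subst₂ _<_ (toℕ-combine i k) (toℕ-combine i l) cik<cjl))

injective⇒surjective : ∀ {n} {h : Fin n → Fin n} → Injective _≡_ _≡_ h → ∀ y → ∃ λ x → y ≡ h x
injective⇒surjective {n} {h} h-inj y with any? (λ x → y ≟ h x)
... | yes y∈im = y∈im
... | no  y∉im = contradiction (injective⇒≤ h′-injective) (<-irrefl refl)
  where
  h′ : Fin (suc n) → Fin n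
  h′ zero    = y
  h′ (suc x) = h x
  h′-injective : Injective _≡_ _≡_ h′
  h′-injective {zero}  {zero}  _   = refl
  h′-injective {zero}  {suc x} y≡hx = contradiction (x , y≡hx) y∉im
  h′-injective {suc x} {zero}  hx≡y = contradiction (x , sym hx≡y) y∉im
  h′-injective {suc x} {suc z} hx≡hz = cong suc (h-inj hx≡hz)

prime⇒n>1 : ∀ {p} → Prime p → 1 < p
prime⇒n>1 {p} p-prime = nonTrivial⇒n>1 p {{prime⇒nonTrivial p-prime}}

pred∘pred≡∸2 : ∀ m → pred (pred m) ≡ m ∸ 2
pred∘pred≡∸2 zero          = refl
pred∘pred≡∸2 (suc zero)    = refl
pred∘pred≡∸2 (suc (suc m)) = refl

double-< : ∀ {a b} → a < b → 2 + 2 * a ≤ 2 * b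
double-< {a} {b} a<b = subst (_≤ 2 * b) (*-suc 2 a) (*-monoʳ-≤ 2 a<b)

Apart : ℕ → ℕ → ℕ → Set
Apart d x y = x + d ≤ y ⊎ y + d ≤ x

Apart-sym : ∀ {d x y} → Apart d x y → Apart d y x
Apart-sym (inj₁ x+d≤y) = inj₂ x+d≤y
Apart-sym (inj₂ y+d≤x) = inj₁ y+d≤x

Apart-weaken : ∀ {d x y} → Apart (suc d) x y → Apart d x y
Apart-weaken {d} {x} (inj₁ x+d+1≤y) = inj₁ (≤-trans (+-monoʳ-≤ x (n≤1+n d)) x+d+1≤y)
Apart-weaken {d} {y = y} (inj₂ y+d+1≤x) = inj₂ (≤-trans (+-monoʳ-≤ y (n≤1+n d)) y+d+1≤x)

Apart-shift : ∀ {d x y} c → Apart d x y → Apart d (c + x) (c + y)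
Apart-shift {d} {x} {y} c = Data.Sum.map (shift x y) (shift y x)
  where shift : ∀ x y → x + d ≤ y → c + x + d ≤ c + y
        shift x y x+d≤y = subst (_≤ c + y) (sym (+-assoc c x d)) (+-monoʳ-≤ c x+d≤y)

Apart⇒≢ : ∀ {d x y} → Apart (suc d) x y → x ≢ y
Apart⇒≢ {d} {x} (inj₁ x+d+1≤y) refl = <-irrefl refl (<-≤-trans (m<m+n x z<s) x+d+1≤y)
Apart⇒≢ {d} {x} (inj₂ x+d+1≤x) refl = <-irrefl refl (<-≤-trans (m<m+n x z<s) x+d+1≤x)

≢⇒Apart : ∀ {x y} → x ≢ y → Apart 1 x y
≢⇒Apart {x} {y} x≢y with <-cmp x y
... | tri< x<y _ _ = inj₁ (subst (_≤ y) (+-comm 1 x) x<y)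
... | tri≈ _ x≡y _ = contradiction x≡y x≢y
... | tri> _ _ y<x = inj₂ (subst (_≤ x) (+-comm 1 y) y<x)

close⇒¬Apart : ∀ {x y} → y ≤ suc x → x ≤ suc y → ¬ Apart 2 x y
close⇒¬Apart {x} {y} y≤1+x _ (inj₁ x+2≤y) = <-irrefl refl (≤-trans (subst (_≤ y) (+-comm x 2) x+2≤y) y≤1+x)
close⇒¬Apart {x} {y} _ x≤1+y (inj₂ y+2≤x) = <-irrefl refl (≤-trans (subst (_≤ x) (+-comm y 2) y+2≤x) x≤1+y)

-- Evens for arguments below h, odds from h on: arguments less than h − 1 apart get images at least 2 apart.
interleave : ℕ → ℕ → ℕ
interleave h i with i <? h
... | yes _ = 2 * i
... | no _  = suc (2 * (i ∸ h))

interleave-injective : ∀ h {i j} → interleave h i ≡ interleave h j → i ≡ j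
interleave-injective h {i} {j} σi≡σj with i <? h | j <? h
... | yes _   | yes _   = *-cancelˡ-≡ i j 2 σi≡σj
... | yes _   | no _    = contradiction σi≡σj (even≢odd i (j ∸ h))
... | no _    | yes _   = contradiction (sym σi≡σj) (even≢odd j (i ∸ h))
... | no i≮h  | no j≮h  =
  ∸-cancelʳ-≡ (≮⇒≥ i≮h) (≮⇒≥ j≮h) (*-cancelˡ-≡ (i ∸ h) (j ∸ h) 2 (suc-injective σi≡σj))

interleave-bound : ∀ {h m i} → 2 * h ≤ m → m ≤ suc (2 * h) → suc i < m → 2 + interleave h i ≤ m
interleave-bound {h} {m} {i} 2h≤m m≤2h+1 i+1<m with i <? h
... | yes i<h = ≤-trans (double-< i<h) 2h≤m
... | no i≮h  = begin
  2 + suc (2 * t)      ≡⟨ solve 1 (λ t → con 2 :+ (con 1 :+ con 2 :* t) := (con 2 :+ t) :+ (con 1 :+ t)) refl t ⟩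
  (2 + t) + suc t      ≤⟨ +-monoʳ-≤ (2 + t) t<h ⟩
  (2 + t) + h          ≡⟨ cong suc (cong suc (trans (+-comm t h) h+t≡i)) ⟩
  2 + i                ≤⟨ i+1<m ⟩
  m                    ∎
  where
  open ≤-Reasoning
  t = i ∸ h
  h+t≡i : h + t ≡ i
  h+t≡i = m+[n∸m]≡n (≮⇒≥ i≮h)
  t<h : suc t ≤ h
  t<h = +-cancelˡ-≤ h (suc t) h (≤-pred (begin
    suc (h + suc t)      ≡⟨ cong suc (+-suc h t) ⟩
    2 + (h + t)          ≡⟨ cong (2 +_) h+t≡i ⟩
    2 + i                ≤⟨ i+1<m ⟩
    m                    ≤⟨ m≤2h+1 ⟩
    suc (2 * h)          ≡⟨ cong (λ x → suc (h + x)) (+-identityʳ h) ⟩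
    suc (h + h)          ∎))

interleave-apart : ∀ h {i j} → i < j → j ≤ i + (h ∸ 2) → Apart 2 (interleave h i) (interleave h j)
interleave-apart h {i} {j} i<j j≤i+h-2 with i <? h | j <? h
... | yes _   | yes _   = inj₁ (subst (_≤ 2 * j) (+-comm 2 (2 * i)) (double-< i<j))
... | no i≮h  | yes j<h = contradiction (<-trans i<j j<h) i≮h
... | no i≮h  | no _    =
  inj₁ (s≤s (subst (_≤ 2 * (j ∸ h)) (+-comm 2 _) (double-< (∸-monoˡ-< i<j (≮⇒≥ i≮h)))))
... | yes _   | no j≮h  = inj₂ (begin
  suc (2 * t) + 2        ≤⟨ n≤1+n _ ⟩
  suc (suc (2 * t) + 2)  ≡⟨ solve 1 (λ t → con 1 :+ ((con 1 :+ con 2 :* t) :+ con 2) := con 2 :* (t :+ con 2)) refl t ⟩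
  2 * (t + 2)            ≤⟨ *-monoʳ-≤ 2 (t+2≤i h (≮⇒≥ j≮h) i<j j≤i+h-2) ⟩
  2 * i                  ∎)
  where
  open ≤-Reasoning
  t = j ∸ h
  t+2≤i : ∀ h {i j} → h ≤ j → i < j → j ≤ i + (h ∸ 2) → (j ∸ h) + 2 ≤ i
  t+2≤i 0 _ i<j j≤i = contradiction (≤-trans j≤i (≤-reflexive (+-identityʳ _))) (<⇒≱ i<j)
  t+2≤i 1 _ i<j j≤i = contradiction (≤-trans j≤i (≤-reflexive (+-identityʳ _))) (<⇒≱ i<j)
  t+2≤i (suc (suc h)) {i} {j} h+2≤j _ j≤i+h = +-cancelʳ-≤ h _ _ (begin
    (j ∸ suc (suc h)) + 2 + h    ≡⟨ +-assoc (j ∸ suc (suc h)) 2 h ⟩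
    (j ∸ suc (suc h)) + (2 + h)  ≡⟨ m∸n+n≡m h+2≤j ⟩
    j                            ≤⟨ j≤i+h ⟩
    i + h                        ∎)

2⌊n/2⌋≤n : ∀ n → 2 * ⌊ n /2⌋ ≤ n
2⌊n/2⌋≤n n = subst (2 * ⌊ n /2⌋ ≤_) (⌊n/2⌋+⌈n/2⌉≡n n)
  (+-monoʳ-≤ ⌊ n /2⌋ (subst (_≤ ⌈ n /2⌉) (sym (+-identityʳ _)) (⌊n/2⌋≤⌈n/2⌉ n)))

n≤1+2⌊n/2⌋ : ∀ n → n ≤ suc (2 * ⌊ n /2⌋)
n≤1+2⌊n/2⌋ n = begin
  n                        ≡⟨ ⌊n/2⌋+⌈n/2⌉≡n n ⟨
  ⌊ n /2⌋ + ⌈ n /2⌉        ≤⟨ +-monoʳ-≤ ⌊ n /2⌋ (⌊n/2⌋-mono (n≤1+n (suc n))) ⟩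
  ⌊ n /2⌋ + suc ⌊ n /2⌋    ≡⟨ +-suc ⌊ n /2⌋ ⌊ n /2⌋ ⟩
  suc (⌊ n /2⌋ + ⌊ n /2⌋)  ≡⟨ cong (λ x → suc (⌊ n /2⌋ + x)) (+-identityʳ _) ⟨
  suc (2 * ⌊ n /2⌋)        ∎
  where open ≤-Reasoning

2m≤n⇒m≤⌊n/2⌋ : ∀ {m n} → 2 * m ≤ n → m ≤ ⌊ n /2⌋
2m≤n⇒m≤⌊n/2⌋ {m} 2m≤n = subst (_≤ _) ⌊2m/2⌋≡m (⌊n/2⌋-mono 2m≤n)
  where ⌊2m/2⌋≡m = sym (trans (n≡⌊n+n/2⌋ m) (cong (λ x → ⌊ m + x /2⌋) (sym (+-identityʳ m))))

module _ {n a b : ℕ} {f : Fin n → ℕ} (a≤f : ∀ v → a ≤ f v) (f≤b : ∀ v → f v ≤ b) where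

  private
    toFin : Fin n → Fin (suc (b ∸ a))
    toFin v = fromℕ< (s≤s (∸-monoˡ-≤ a (f≤b v)))

    toℕ-toFin : ∀ v → toℕ (toFin v) ≡ f v ∸ a
    toℕ-toFin v = toℕ-fromℕ< (s≤s (∸-monoˡ-≤ a (f≤b v)))

  injective-avoiding⇒≤ : ∀ {h} → Injective _≡_ _≡_ f → a ≤ h → h ≤ b → (∀ v → f v ≢ h) →
                         n ≤ b ∸ a
  injective-avoiding⇒≤ {h} f-inj a≤h h≤b f≢h = injective⇒≤ {f = ψ} ψ-injective
    where
    hole : Fin (suc (b ∸ a))
    hole = fromℕ< (s≤s (∸-monoˡ-≤ a h≤b))
    hole≢toFin : ∀ v → hole ≢ toFin v
    hole≢toFin v hole≡toFin = f≢h v (∸-cancelʳ-≡ (a≤f v) a≤h (begin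
      f v ∸ a          ≡⟨ toℕ-toFin v ⟨
      toℕ (toFin v)    ≡⟨ cong toℕ hole≡toFin ⟨
      toℕ hole         ≡⟨ toℕ-fromℕ< (s≤s (∸-monoˡ-≤ a h≤b)) ⟩
      h ∸ a            ∎))
      where open ≡-Reasoning
    ψ : Fin n → Fin (b ∸ a)
    ψ v = punchOut (hole≢toFin v)
    ψ-injective : Injective _≡_ _≡_ ψ
    ψ-injective {u} {v} ψu≡ψv = f-inj (∸-cancelʳ-≡ (a≤f u) (a≤f v) (begin
      f u ∸ a          ≡⟨ toℕ-toFin u ⟨
      toℕ (toFin u)    ≡⟨ cong toℕ (punchOut-injective (hole≢toFin u) (hole≢toFin v) ψu≡ψv) ⟩
      toℕ (toFin v)    ≡⟨ toℕ-toFin v ⟩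
      f v ∸ a          ∎))
      where open ≡-Reasoning

  apart⇒≤ : (∀ u v → u ≢ v → Apart 2 (f u) (f v)) → 2 * (n ∸ 1) ≤ b ∸ a
  apart⇒≤ f-apart = ≤-trans (*-monoʳ-≤ 2 (∸-monoˡ-≤ 1 (injective⇒≤ ψ-injective))) (2⌊n/2⌋≤n (b ∸ a))
    where
    -- Labels at least 2 apart stay distinct after halving.
    ψ : Fin n → Fin (suc ⌊ b ∸ a /2⌋)
    ψ v = fromℕ< (s≤s (⌊n/2⌋-mono (∸-monoˡ-≤ a (f≤b v))))
    ⌊/2⌋-separates : ∀ {x y} → a ≤ x → x + 2 ≤ y → ⌊ x ∸ a /2⌋ < ⌊ y ∸ a /2⌋
    ⌊/2⌋-separates {x} {y} a≤x x+2≤y =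
      ⌊n/2⌋-mono (subst (_≤ y ∸ a) (trans (+-∸-comm 2 a≤x) (+-comm (x ∸ a) 2)) (∸-monoˡ-≤ a x+2≤y))
    ψ-injective : Injective _≡_ _≡_ ψ
    ψ-injective {u} {v} ψu≡ψv with u ≟ v
    ... | yes u≡v = u≡v
    ... | no u≢v with f-apart u v u≢v
    ...   | inj₁ fu+2≤fv =
      contradiction (fromℕ<-injective _ _ _ _ ψu≡ψv) (<⇒≢ (⌊/2⌋-separates (a≤f u) fu+2≤fv))
    ...   | inj₂ fv+2≤fu =
      contradiction (fromℕ<-injective _ _ _ _ (sym ψu≡ψv)) (<⇒≢ (⌊/2⌋-separates (a≤f v) fv+2≤fu))

module PowerLaws {n : ℕ} (G : FinGroup n) where

  open FinGroup G public
  open IsGroup isGroup using (assoc; identityˡ; identityʳ)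

  asGroup : Group 0ℓ 0ℓ
  asGroup = record { isGroup = isGroup }

  open import Algebra.Properties.Group asGroup public using (∙-cancelˡ; ∙-cancelʳ)

  infixr 25 _^_
  _^_ : Fin n → ℕ → Fin n
  _^_ = pow G

  ^-+ : ∀ g a b → g ^ (a + b) ≡ g ^ a ∙ g ^ b
  ^-+ g zero    b = sym (identityˡ _)
  ^-+ g (suc a) b = trans (cong (g ∙_) (^-+ g a b)) (sym (assoc g _ _))

  ^-* : ∀ g a b → g ^ (a * b) ≡ (g ^ a) ^ b
  ^-* g a zero    = cong (g ^_) (*-zeroʳ a)
  ^-* g a (suc b) = begin
    g ^ (a * suc b)        ≡⟨ cong (g ^_) (*-suc a b) ⟩
    g ^ (a + a * b)        ≡⟨ ^-+ g a (a * b) ⟩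
    g ^ a ∙ g ^ (a * b)    ≡⟨ cong (g ^ a ∙_) (^-* g a b) ⟩
    g ^ a ∙ (g ^ a) ^ b    ∎
    where open ≡-Reasoning

  ε^ : ∀ k → ε ^ k ≡ ε
  ε^ zero    = refl
  ε^ (suc k) = trans (cong (ε ∙_) (ε^ k)) (identityˡ ε)

  ^-multiple : ∀ {g p} → g ^ p ≡ ε → ∀ m → g ^ (m * p) ≡ ε
  ^-multiple {g} {p} gᵖ≡ε m = begin
    g ^ (m * p)    ≡⟨ cong (g ^_) (*-comm m p) ⟩
    g ^ (p * m)    ≡⟨ ^-* g p m ⟩
    (g ^ p) ^ m    ≡⟨ cong (_^ m) gᵖ≡ε ⟩
    ε ^ m          ≡⟨ ε^ m ⟩
    ε              ∎
    where open ≡-Reasoning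

  ^-% : ∀ {g p} .{{_ : NonZero p}} → g ^ p ≡ ε → ∀ k → g ^ k ≡ g ^ (k % p)
  ^-% {g} {p} gᵖ≡ε k = begin
    g ^ k                           ≡⟨ cong (g ^_) (m≡m%n+[m/n]*n k p) ⟩
    g ^ (k % p + (k / p) * p)       ≡⟨ ^-+ g (k % p) _ ⟩
    g ^ (k % p) ∙ g ^ ((k / p) * p) ≡⟨ cong (g ^ (k % p) ∙_) (^-multiple gᵖ≡ε (k / p)) ⟩
    g ^ (k % p) ∙ ε                 ≡⟨ identityʳ _ ⟩
    g ^ (k % p)                     ∎
    where open ≡-Reasoning

  order-nonZero : ∀ {g p} → HasOrder G g p → NonZero p
  order-nonZero (0<p , _) = >-nonZero 0<p

  ^-distinct : ∀ {g p i j} → HasOrder G g p → i < j → j < p → g ^ i ≢ g ^ j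
  ^-distinct {g} {p} {i} {j} (_ , _ , minimal) i<j j<p gⁱ≡gʲ =
    minimal (j ∸ i) (m<n⇒0<n∸m i<j) (≤-<-trans (m∸n≤m j i) j<p) (∙-cancelˡ (g ^ i) _ _ (begin
      g ^ i ∙ g ^ (j ∸ i)  ≡⟨ ^-+ g i (j ∸ i) ⟨
      g ^ (i + (j ∸ i))    ≡⟨ cong (g ^_) (m+[n∸m]≡n (<⇒≤ i<j)) ⟩
      g ^ j                ≡⟨ gⁱ≡gʲ ⟨
      g ^ i                ≡⟨ identityʳ _ ⟨
      g ^ i ∙ ε            ∎))
    where open ≡-Reasoning

  ^-injective : ∀ {g p i j} → HasOrder G g p → i < p → j < p → g ^ i ≡ g ^ j → i ≡ j
  ^-injective {i = i} {j} ord i<p j<p gⁱ≡gʲ with <-cmp i j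
  ... | tri< i<j _ _ = contradiction gⁱ≡gʲ (^-distinct ord i<j j<p)
  ... | tri≈ _ i≡j _ = i≡j
  ... | tri> _ _ j<i = contradiction (sym gⁱ≡gʲ) (^-distinct ord j<i i<p)

  ^-toℕ-injective : ∀ {g p} → HasOrder G g p → Injective _≡_ _≡_ (λ (k : Fin p) → g ^ toℕ k)
  ^-toℕ-injective ord gᵏ≡gˡ = toℕ-injective (^-injective ord (toℕ<n _) (toℕ<n _) gᵏ≡gˡ)

  nonidentity-power : ∀ {g p} → HasOrder G g p → ∀ k → g ^ k ≢ ε → ∃ λ i → suc i < p × g ^ k ≡ g ^ suc i
  nonidentity-power {g} {suc q} (_ , gᵖ≡ε , _) k gᵏ≢ε with k % suc q in k%p≡r
  ... | zero  = contradiction (trans (^-% gᵖ≡ε k) (cong (g ^_) k%p≡r)) gᵏ≢ε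
  ... | suc i = i , subst (_< suc q) k%p≡r (m%n<n k (suc q)) , trans (^-% gᵖ≡ε k) (cong (g ^_) k%p≡r)

  generator-from-Bézout : ∀ {g q r} → g ^ suc q ≡ ε → Bézout.Identity 1 r (suc q) → ∃ λ c → g ≡ (g ^ r) ^ c
  generator-from-Bézout {g} {q} {r} gᵖ≡ε (Bézout.+- x y 1+yp≡xr) = x , (begin
    g                  ≡⟨ identityʳ g ⟨
    g ∙ ε              ≡⟨ cong (g ∙_) (^-multiple gᵖ≡ε y) ⟨
    g ^ (1 + y * p)    ≡⟨ cong (g ^_) 1+yp≡xr ⟩
    g ^ (x * r)        ≡⟨ cong (g ^_) (*-comm x r) ⟩
    g ^ (r * x)        ≡⟨ ^-* g r x ⟩
    (g ^ r) ^ x        ∎)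
    where open ≡-Reasoning
          p = suc q
  -- Both g and (g ^ r) ^ (x * q) are left inverses of (g ^ r) ^ x.
  generator-from-Bézout {g} {q} {r} gᵖ≡ε (Bézout.-+ x y 1+xr≡yp) =
    x * q , ∙-cancelʳ ((g ^ r) ^ x) g ((g ^ r) ^ (x * q)) (trans g∙hˣ≡ε (sym hˣᑫ∙hˣ≡ε))
    where
    open ≡-Reasoning
    p = suc q
    g∙hˣ≡ε : g ∙ (g ^ r) ^ x ≡ ε
    g∙hˣ≡ε = begin
      g ∙ (g ^ r) ^ x    ≡⟨ cong (g ∙_) (^-* g r x) ⟨
      g ^ (1 + r * x)    ≡⟨ cong (λ e → g ^ (1 + e)) (*-comm r x) ⟩
      g ^ (1 + x * r)    ≡⟨ cong (g ^_) 1+xr≡yp ⟩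
      g ^ (y * p)        ≡⟨ ^-multiple gᵖ≡ε y ⟩
      ε                  ∎
    hˣᑫ∙hˣ≡ε : (g ^ r) ^ (x * q) ∙ (g ^ r) ^ x ≡ ε
    hˣᑫ∙hˣ≡ε = begin
      (g ^ r) ^ (x * q) ∙ (g ^ r) ^ x  ≡⟨ ^-+ (g ^ r) (x * q) x ⟨
      (g ^ r) ^ (x * q + x)            ≡⟨ cong ((g ^ r) ^_) (trans (+-comm (x * q) x) (sym (*-suc x q))) ⟩
      (g ^ r) ^ (x * p)                ≡⟨ ^-* g r (x * p) ⟨
      g ^ (r * (x * p))                ≡⟨ cong (g ^_) (*-assoc r x p) ⟨
      g ^ ((r * x) * p)                ≡⟨ ^-multiple gᵖ≡ε (r * x) ⟩
      ε                                ∎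

  power-generates : ∀ {g p} → Prime p → HasOrder G g p → ∀ k → g ^ k ≢ ε → ∃ λ c → g ≡ (g ^ k) ^ c
  power-generates {g} {suc q} p-prime ord@(_ , gᵖ≡ε , _) k gᵏ≢ε
    with i , r<p , gᵏ≡gʳ ← nonidentity-power ord k gᵏ≢ε
    with c , g≡hᶜ ← generator-from-Bézout gᵖ≡ε (coprime-Bézout (Coprime.sym (prime⇒coprime p-prime r<p)))
    = c , trans g≡hᶜ (cong (_^ c) (sym gᵏ≡gʳ))

  ^-inverse : ∀ {g q} → g ^ suc q ≡ ε → ∀ k → g ^ k ∙ g ^ (q * k) ≡ ε
  ^-inverse {g} {q} gᵖ≡ε k = begin
    g ^ k ∙ g ^ (q * k)  ≡⟨ ^-+ g k (q * k) ⟨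
    g ^ (suc q * k)      ≡⟨ cong (g ^_) (*-comm (suc q) k) ⟩
    g ^ (k * suc q)      ≡⟨ ^-multiple gᵖ≡ε k ⟩
    ε                    ∎
    where open ≡-Reasoning

module Lagrange {n : ℕ} (G : FinGroup n) {g : Fin n} {q : ℕ} (ord : HasOrder G g (suc q)) where

  open PowerLaws G
  open IsGroup isGroup using (assoc; identityʳ)

  private
    p = suc q
    gᵖ≡ε = proj₁ (proj₂ ord)

  _∈_·⟨g⟩ : Fin n → Fin n → Set
  y′ ∈ y ·⟨g⟩ = ∃ λ k → y′ ≡ y ∙ g ^ k

  ∈·⟨g⟩-sym : ∀ {y y′} → y′ ∈ y ·⟨g⟩ → y ∈ y′ ·⟨g⟩
  ∈·⟨g⟩-sym {y} {y′} (k , refl) = q * k , (begin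
    y                          ≡⟨ identityʳ y ⟨
    y ∙ ε                      ≡⟨ cong (y ∙_) (^-inverse {q = q} gᵖ≡ε k) ⟨
    y ∙ (g ^ k ∙ g ^ (q * k))  ≡⟨ assoc y _ _ ⟨
    (y ∙ g ^ k) ∙ g ^ (q * k)  ∎)
    where open ≡-Reasoning

  ∈·⟨g⟩-trans : ∀ {y y′ y″} → y′ ∈ y ·⟨g⟩ → y″ ∈ y′ ·⟨g⟩ → y″ ∈ y ·⟨g⟩
  ∈·⟨g⟩-trans {y} (a , refl) (b , refl) = a + b , trans (assoc y _ _) (cong (y ∙_) (sym (^-+ g a b)))

  cosetRep : Fin n → Fin n
  cosetRep y = leastOf (λ k → y ∙ g ^ k) p

  cosetRep-≤ : ∀ {y y′} → y′ ∈ y ·⟨g⟩ → toℕ (cosetRep y) ≤ toℕ y′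
  cosetRep-≤ {y} (k , refl) = subst (λ z → toℕ (cosetRep y) ≤ toℕ (y ∙ z)) (sym (^-% gᵖ≡ε k))
    (leastOf-≤ (λ k → y ∙ g ^ k) (m%n<n k p))

  cosetRep-∈ : ∀ y → cosetRep y ∈ y ·⟨g⟩
  cosetRep-∈ y with i , _ , rep≡ ← leastOf-∈ (λ k → y ∙ g ^ k) {p} z<s = i , rep≡

  cosetRep-cong : ∀ {y y′} → y′ ∈ y ·⟨g⟩ → cosetRep y′ ≡ cosetRep y
  cosetRep-cong y′∈y·⟨g⟩ = toℕ-injective (≤-antisym
    (cosetRep-≤ (∈·⟨g⟩-trans (∈·⟨g⟩-sym y′∈y·⟨g⟩) (cosetRep-∈ _)))
    (cosetRep-≤ (∈·⟨g⟩-trans y′∈y·⟨g⟩ (cosetRep-∈ _))))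

  cosetRep≡⇒∈ : ∀ {y y′} → cosetRep y′ ≡ cosetRep y → y′ ∈ y ·⟨g⟩
  cosetRep≡⇒∈ {y} {y′} rep≡ = ∈·⟨g⟩-trans (cosetRep-∈ y)
    (subst (λ z → y′ ∈ z ·⟨g⟩) rep≡ (∈·⟨g⟩-sym (cosetRep-∈ y′)))

  coset-count : ∀ c → p ∣ count (λ y → cosetRep y ≟ c)
  coset-count c with any? (λ y → cosetRep y ≟ c)
  ... | no ∄y = subst (p ∣_) (sym (count-empty (λ y → cosetRep y ≟ c) (λ y rep≡c → ∄y (y , rep≡c)))) (p ∣0)
  ... | yes (y₀ , refl) = subst (p ∣_) (sym fibre≡p) ∣-refl
    where
    h : Fin p → Fin n
    h k = y₀ ∙ g ^ toℕ k
    h-injective : Injective _≡_ _≡_ h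
    h-injective hk≡hl = ^-toℕ-injective ord (∙-cancelˡ y₀ _ _ hk≡hl)
    coset⇒h : ∀ {y} → y ∈ y₀ ·⟨g⟩ → ∃ λ k → y ≡ h k
    coset⇒h (k , refl) = k mod p , cong (y₀ ∙_) (trans (^-% gᵖ≡ε k) (cong (g ^_) (sym (toℕ-fromℕ< (m%n<n k p)))))
    fibre≡p : count (λ y → cosetRep y ≟ cosetRep y₀) ≡ p
    fibre≡p = count-image (λ y → cosetRep y ≟ cosetRep y₀) h h-injective
      (λ rep≡ → coset⇒h (cosetRep≡⇒∈ rep≡)) (λ k → cosetRep-cong {y₀} (toℕ k , refl))

  lagrange : p ∣ n
  lagrange = subst (p ∣_) (count-fibres cosetRep) (∑-∣ coset-count)

order-∣ : ∀ {n} (G : FinGroup n) {g p} → HasOrder G g p → p ∣ n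
order-∣ G {p = suc q} ord = Lagrange.lagrange G ord

module PowerGraph {n : ℕ} (G : FinGroup n) where

  open FinGroup G using (ε)

  ε-adjacent : ∀ {v} → v ≢ ε → Adj G ε v
  ε-adjacent v≢ε = (λ ε≡v → v≢ε (sym ε≡v)) , inj₁ (0 , refl)

  nonidentity-exists : 1 < n → ∃ λ w → w ≢ ε
  nonidentity-exists (s≤s (s≤s _)) with ε ≟ zero
  ... | yes ε≡0 = suc zero , λ 1≡ε → 0≢1+n (trans (sym ε≡0) (sym 1≡ε))
  ... | no ε≢0  = zero , λ 0≡ε → ε≢0 (sym 0≡ε)

  module _ (f : Fin n → ℕ) where

    LambdaIs-intro : ∀ {m} → IsL21 G f → span G f ≤ m → (∀ g → IsL21 G g → m ≤ span G g) → LambdaIs G m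
    LambdaIs-intro f-L21 span≤m m≤spans = (f , f-L21 , ≤-antisym span≤m (m≤spans f f-L21)) , m≤spans

    minLabel≤ : ∀ v → minLabel G f ≤ f v
    minLabel≤ v = foldr-preservesᵒ {P = _≤ f v} {f = _⊓_}
      (λ x y → Data.Sum.[ m≤n⇒m⊓o≤n y , m≤n⇒o⊓m≤n x ]) _ (map f (allFin n))
      (inj₂ (lose (∈-map⁺ f (∈-allFin v)) ≤-refl))

    ≤maxLabel : ∀ v → f v ≤ maxLabel G f
    ≤maxLabel v = foldr-preservesᵒ {P = f v ≤_} {f = _⊔_}
      (λ x y → Data.Sum.[ m≤n⇒m≤n⊔o y , m≤n⇒m≤o⊔n x ]) _ (map f (allFin n))
      (inj₂ (lose (∈-map⁺ f (∈-allFin v)) ≤-refl))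

    span≤ : ∀ {M} → (∀ v → f v ≤ M) → span G f ≤ M
    span≤ {M} f≤M = ≤-trans (m∸n≤m (maxLabel G f) (minLabel G f))
      (foldr-preservesᵇ {P = _≤ M} ⊔-lub z≤n (All.tabulate λ fv∈ → bounded (∈-map⁻ f fv∈)))
      where bounded : ∀ {x} → ∃ (λ v → v ∈ allFin n × x ≡ f v) → x ≤ M
            bounded (v , _ , refl) = f≤M v

    apart⇒IsL21 : (∀ u v → u ≢ v → Apart 2 (f u) (f v)) → IsL21 G f
    apart⇒IsL21 f-apart = (λ u v (u≢v , _) → f-apart u v u≢v)
                        , (λ u v (u≢v , _) → Apart-weaken (f-apart u v u≢v))

    module _ (f-L21 : IsL21 G f) where

      private
        adjacent-apart = proj₁ f-L21
        dist2-apart    = proj₂ f-L21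

      IsL21⇒injective : Injective _≡_ _≡_ f
      IsL21⇒injective {u} {v} fu≡fv with u ≟ v | u ≟ ε | v ≟ ε
      ... | yes u≡v | _ | _ = u≡v
      ... | no u≢v | yes u≡ε | _ = contradiction fu≡fv (Apart⇒≢ (adjacent-apart u v (u≢v , inj₁ (0 , u≡ε))))
      ... | no u≢v | _ | yes v≡ε = contradiction fu≡fv (Apart⇒≢ (adjacent-apart u v (u≢v , inj₂ (0 , v≡ε))))
      ... | no u≢v | no u≢ε | no v≢ε =
        contradiction fu≡fv (Apart⇒≢ (dist2-apart u v (u≢v , ¬adj , ε , u~ε , ε-adjacent v≢ε)))
        where
        ¬adj = λ adj → Apart⇒≢ (adjacent-apart u v adj) fu≡fv
        u~ε : Adj G u ε
        u~ε = u≢ε , inj₂ (0 , refl)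

      ε-apart : ∀ {v} → v ≢ ε → Apart 2 (f ε) (f v)
      ε-apart v≢ε = adjacent-apart ε _ (ε-adjacent v≢ε)

      unused-near-f[ε] : ∀ {h} → h ≢ f ε → h ≤ suc (f ε) → f ε ≤ suc h → ∀ v → f v ≢ h
      unused-near-f[ε] h≢fε h≤1+fε fε≤1+h v fv≡h with v ≟ ε
      ... | yes v≡ε = h≢fε (trans (sym fv≡h) (cong f v≡ε))
      ... | no v≢ε  = close⇒¬Apart (subst (_≤ suc (f ε)) (sym fv≡h) h≤1+fε)
                                   (subst (λ x → f ε ≤ suc x) (sym fv≡h) fε≤1+h) (ε-apart v≢ε)

      span≥n : 1 < n → n ≤ span G f
      span≥n 1<n with f ε <? maxLabel G f
      ... | yes fε<max = injective-avoiding⇒≤ minLabel≤ ≤maxLabel IsL21⇒injective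
          (≤-trans (minLabel≤ ε) (n≤1+n _)) fε<max
          (unused-near-f[ε] 1+n≢n ≤-refl (≤-trans (n≤1+n _) (n≤1+n _)))
      ... | no fε≮max with w , w≢ε ← nonidentity-exists 1<n =
        injective-avoiding⇒≤ minLabel≤ ≤maxLabel IsL21⇒injective
          (≤-trans (minLabel≤ w) (m+n≤o⇒m≤o∸n (f w) (≤-trans (+-monoʳ-≤ (f w) (n≤1+n 1)) fw+2≤fε)))
          (≤-trans (m∸n≤m (f ε) 1) (≤maxLabel ε))
          (unused-near-f[ε] (<⇒≢ (∸-monoʳ-< z<s 1≤fε)) (≤-trans (m∸n≤m (f ε) 1) (n≤1+n _))
                            (m≤n+m∸n (f ε) 1))
        where
        fw+2≤fε : f w + 2 ≤ f ε
        fw+2≤fε with ε-apart w≢ε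
        ... | inj₁ fε+2≤fw =
          contradiction (<-≤-trans (m<m+n (f ε) z<s) (≤-trans fε+2≤fw (≤maxLabel w))) fε≮max
        ... | inj₂ fw+2≤fε = fw+2≤fε
        1≤fε : 1 ≤ f ε
        1≤fε = ≤-trans (m≤n+m 1 (f w + 1)) (subst (_≤ f ε) (sym (+-assoc (f w) 1 1)) fw+2≤fε)

      span≥2[n-1] : (∀ {u v} → u ≢ v → Adj G u v) → 2 * (n ∸ 1) ≤ span G f
      span≥2[n-1] complete = apart⇒≤ minLabel≤ ≤maxLabel (λ u v u≢v → adjacent-apart u v (complete u≢v))

  twiceIndex : Fin n → ℕ
  twiceIndex v = 2 * toℕ v

  twiceIndex-IsL21 : IsL21 G twiceIndex
  twiceIndex-IsL21 = apart⇒IsL21 twiceIndex apart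
    where
    apart : ∀ u v → u ≢ v → Apart 2 (twiceIndex u) (twiceIndex v)
    apart u v u≢v with <-cmp (toℕ u) (toℕ v)
    ... | tri< u<v _ _ = inj₁ (subst (_≤ twiceIndex v) (+-comm 2 (twiceIndex u)) (double-< u<v))
    ... | tri≈ _ u≡v _ = contradiction (toℕ-injective u≡v) u≢v
    ... | tri> _ _ v<u = inj₂ (subst (_≤ twiceIndex u) (+-comm 2 (twiceIndex v)) (double-< v<u))

  span-twiceIndex : span G twiceIndex ≤ 2 * (n ∸ 1)
  span-twiceIndex = span≤ twiceIndex (λ v → *-monoʳ-≤ 2 (∸-monoˡ-≤ 1 (toℕ<n v)))

module PrimeOrders {n : ℕ} (G : FinGroup n)
                     (prime-orders : ∀ g → g ≢ FinGroup.ε G → HasPrimeOrder G g) where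

  open PowerLaws G

  order : Fin n → ℕ
  order g with g ≟ ε
  ... | yes _  = 1
  ... | no g≢ε = proj₁ (prime-orders g g≢ε)

  order-prime : ∀ {g} → g ≢ ε → Prime (order g)
  order-prime {g} g≢ε with g ≟ ε
  ... | yes g≡ε = contradiction g≡ε g≢ε
  ... | no g≢ε  = proj₁ (proj₂ (prime-orders g g≢ε))

  hasOrder : ∀ {g} → g ≢ ε → HasOrder G g (order g)
  hasOrder {g} g≢ε with g ≟ ε
  ... | yes g≡ε = contradiction g≡ε g≢ε
  ... | no g≢ε  = proj₂ (proj₂ (prime-orders g g≢ε))

  ^≢ε⇒≢ε : ∀ {g} k → g ^ k ≢ ε → g ≢ ε
  ^≢ε⇒≢ε k gᵏ≢ε refl = gᵏ≢ε (ε^ k)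

  -- The least nonidentity power of u; it depends only on the cyclic subgroup ⟨u⟩.
  classRep : Fin n → Fin n
  classRep u = leastOf (λ k → u ^ suc k) (pred (order u))

  classRep-≤ : ∀ {u} j → u ^ j ≢ ε → toℕ (classRep u) ≤ toℕ (u ^ j)
  classRep-≤ {u} j uʲ≢ε
    with i , i+1<p , uʲ≡uⁱ⁺¹ ← nonidentity-power (hasOrder (^≢ε⇒≢ε j uʲ≢ε)) j uʲ≢ε =
    subst (λ z → toℕ (classRep u) ≤ toℕ z) (sym uʲ≡uⁱ⁺¹) (leastOf-≤ (λ k → u ^ suc k) (<⇒≤pred i+1<p))

  classRep-∈ : ∀ {u} → u ≢ ε → ∃ λ j → classRep u ≡ u ^ j × u ^ j ≢ ε
  classRep-∈ {u} u≢ε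
    with i , i<p-1 , rep≡uⁱ⁺¹ ← leastOf-∈ (λ k → u ^ suc k) (<⇒≤pred (prime⇒n>1 (order-prime u≢ε)))
    = suc i , rep≡uⁱ⁺¹ , minimal (suc i) z<s (m≤pred[n]⇒suc[m]≤n i<p-1)
    where instance _ = order-nonZero (hasOrder u≢ε)
          minimal = proj₂ (proj₂ (hasOrder u≢ε))

  classRep-antitone : ∀ {u} v → u ≢ ε → IsPowerOf G u v → toℕ (classRep v) ≤ toℕ (classRep u)
  classRep-antitone {u} v u≢ε (a , u≡vᵃ) with j , rep≡uʲ , uʲ≢ε ← classRep-∈ u≢ε =
    subst (λ z → toℕ (classRep v) ≤ toℕ z) (sym (trans rep≡uʲ uʲ≡vᵃʲ))
      (classRep-≤ (a * j) (λ vᵃʲ≡ε → uʲ≢ε (trans uʲ≡vᵃʲ vᵃʲ≡ε)))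
    where
    uʲ≡vᵃʲ : u ^ j ≡ v ^ (a * j)
    uʲ≡vᵃʲ = trans (cong (_^ j) u≡vᵃ) (sym (^-* v a j))

  classRep-cong : ∀ {u v} → u ≢ ε → v ≢ ε → IsPowerOf G u v → classRep u ≡ classRep v
  classRep-cong {u} {v} u≢ε v≢ε (k , u≡vᵏ)
    with c , v≡uᶜ ← power-generates (order-prime v≢ε) (hasOrder v≢ε) k
                                    (λ vᵏ≡ε → u≢ε (trans u≡vᵏ vᵏ≡ε))
    = toℕ-injective (≤-antisym
        (classRep-antitone u v≢ε (c , trans v≡uᶜ (cong (_^ c) (sym u≡vᵏ))))
        (classRep-antitone v u≢ε (k , u≡vᵏ)))

  classRep≡⇒power : ∀ {u w} → u ≢ ε → w ≢ ε → classRep w ≡ classRep u → IsPowerOf G w u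
  classRep≡⇒power {u} {w} u≢ε w≢ε repw≡repu
    with j , repw≡wʲ , wʲ≢ε ← classRep-∈ w≢ε
    with c , w≡wʲᶜ ← power-generates (order-prime w≢ε) (hasOrder w≢ε) j wʲ≢ε
    with a , repu≡uᵃ , _ ← classRep-∈ u≢ε
    = a * c , (begin
      w               ≡⟨ w≡wʲᶜ ⟩
      (w ^ j) ^ c     ≡⟨ cong (_^ c) (trans (sym repw≡wʲ) (trans repw≡repu repu≡uᵃ)) ⟩
      (u ^ a) ^ c     ≡⟨ ^-* u a c ⟨
      u ^ (a * c)     ∎)
    where open ≡-Reasoning

  InClassOf : Fin n → Pred (Fin n) 0ℓ
  InClassOf u w = w ≢ ε × classRep w ≡ classRep u

  inClassOf? : ∀ u → Decidable (InClassOf u)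
  inClassOf? u w = ¬? (w ≟ ε) ×-dec (classRep w ≟ classRep u)

  class-size : ∀ {u} → u ≢ ε → count (inClassOf? u) ≤ pred (order u)
  class-size {u} u≢ε = count-image-≤ (inClassOf? u) (λ k → u ^ suc (toℕ k)) inImage
    where
    inImage : ∀ {w} → InClassOf u w → ∃ λ k → w ≡ u ^ suc (toℕ k)
    inImage (w≢ε , repw≡repu)
      with c , w≡uᶜ ← classRep≡⇒power u≢ε w≢ε repw≡repu
      with i , i+1<p , uᶜ≡uⁱ⁺¹ ← nonidentity-power (hasOrder u≢ε) c
                                                      (λ uᶜ≡ε → w≢ε (trans w≡uᶜ uᶜ≡ε))
      = fromℕ< i<p-1
      , trans w≡uᶜ (trans uᶜ≡uⁱ⁺¹ (cong (λ m → u ^ suc m) (sym (toℕ-fromℕ< i<p-1))))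
      where i<p-1 = <⇒≤pred i+1<p

  -- Elements are ordered lexicographically by (classRep w, w), so that each cyclic subgroup
  -- occupies a block of consecutive ranks.
  key : Fin n → Fin (n * n)
  key w = combine (classRep w) w

  Below : Fin n → Pred (Fin n) 0ℓ
  Below v w = w ≢ ε × toℕ (key w) < toℕ (key v)

  below? : ∀ v → Decidable (Below v)
  below? v w = ¬? (w ≟ ε) ×-dec (toℕ (key w) <? toℕ (key v))

  rank : Fin n → ℕ
  rank v = count (below? v)

  rank-< : ∀ {u v} → u ≢ ε → toℕ (key u) < toℕ (key v) → rank u < rank v
  rank-< {u} {v} u≢ε ku<kv = count-mono-< (below? u) (below? v)
    (λ (w≢ε , kw<ku) → w≢ε , <-trans kw<ku ku<kv) u (λ (_ , ku<ku) → <-irrefl refl ku<ku) (u≢ε , ku<kv)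

  rank-injective : ∀ {u v} → u ≢ ε → v ≢ ε → rank u ≡ rank v → u ≡ v
  rank-injective {u} {v} u≢ε v≢ε ru≡rv with <-cmp (toℕ (key u)) (toℕ (key v))
  ... | tri< ku<kv _ _ = contradiction ru≡rv (<⇒≢ (rank-< u≢ε ku<kv))
  ... | tri≈ _ ku≡kv _ = combine-injectiveʳ (classRep u) u (classRep v) v (toℕ-injective ku≡kv)
  ... | tri> _ _ kv<ku = contradiction (sym ru≡rv) (<⇒≢ (rank-< v≢ε kv<ku))

  rank-bound : ∀ {v} → v ≢ ε → suc (rank v) < n
  rank-bound {v} v≢ε = ≤-<-trans
    (count-mono-< (below? v) nonidentity? proj₁ v (λ (_ , kv<kv) → <-irrefl refl kv<kv) v≢ε)
    (count<n nonidentity? ε (λ ε≢ε → ε≢ε refl))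
    where
    nonidentity? : Decidable (_≢ ε)
    nonidentity? w = ¬? (w ≟ ε)

  rank-close : ∀ {u v} → u ≢ ε → v ≢ ε → classRep u ≡ classRep v → toℕ u < toℕ v →
               rank v ≤ rank u + (order u ∸ 2)
  rank-close {u} {v} u≢ε v≢ε repu≡repv u<v = begin
    rank v                              ≤⟨ count-⊎ (below? v) (below? u) classButV? below-v⊆ ⟩
    rank u + count classButV?           ≤⟨ +-monoʳ-≤ (rank u) classButV≤ ⟩
    rank u + (order u ∸ 2)              ∎
    where
    open ≤-Reasoning
    classButV? : Decidable (λ w → InClassOf u w × w ≢ v)
    classButV? w = inClassOf? u w ×-dec ¬? (w ≟ v)
    below-v⊆ : ∀ {w} → Below v w → Below u w ⊎ (InClassOf u w × w ≢ v)
    below-v⊆ {w} (w≢ε , kw<kv) with combine-<-lex kw<kv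
    ... | inj₁ repw<repv =
      inj₁ (w≢ε , combine-monoˡ-< w u (subst (λ z → toℕ (classRep w) < toℕ z) (sym repu≡repv) repw<repv))
    ... | inj₂ (repw≡repv , w<v) =
      inj₂ ((w≢ε , trans repw≡repv (sym repu≡repv)) , λ w≡v → <-irrefl (cong toℕ w≡v) w<v)
    classButV≤ : count classButV? ≤ order u ∸ 2
    classButV≤ = subst (count classButV? ≤_) (pred∘pred≡∸2 (order u))
      (<⇒≤pred (<-≤-trans
        (count-mono-< classButV? (inClassOf? u) proj₁ v (λ (_ , v≢v) → v≢v refl) (v≢ε , sym repu≡repv))
        (class-size u≢ε)))

  open PowerGraph G

  generates : Prime n → ∀ {v} → v ≢ ε → ∀ u → IsPowerOf G u v
  generates n-prime {v} v≢ε u with prime⇒irreducible n-prime (order-∣ G (hasOrder v≢ε))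
  ... | inj₁ order≡1 = contradiction (subst Prime order≡1 (order-prime v≢ε)) ¬prime[1]
  ... | inj₂ order≡n
    with k , u≡vᵏ ← injective⇒surjective (^-toℕ-injective (subst (HasOrder G v) order≡n (hasOrder v≢ε))) u
    = toℕ k , u≡vᵏ

  complete : Prime n → ∀ {u v} → u ≢ v → Adj G u v
  complete n-prime {u} {v} u≢v with v ≟ ε
  ... | yes v≡ε = u≢v , inj₂ (0 , v≡ε)
  ... | no v≢ε  = u≢v , inj₁ (generates n-prime v≢ε u)

  order≤⌊n/2⌋ : ¬ Prime n → ∀ {g} → g ≢ ε → order g ≤ ⌊ n /2⌋
  order≤⌊n/2⌋ n-composite {g} g≢ε with order-∣ G (hasOrder g≢ε)
  ... | divides zero n≡0 = contradiction (subst (toℕ g <_) n≡0 (toℕ<n g)) λ ()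
  ... | divides (suc zero) n≡p =
    contradiction (subst Prime (sym (trans n≡p (+-identityʳ _))) (order-prime g≢ε)) n-composite
  ... | divides (suc (suc k)) n≡kp =
    2m≤n⇒m≤⌊n/2⌋ (subst (2 * order g ≤_) (sym n≡kp) (*-monoˡ-≤ (order g) (s≤s (s≤s (z≤n {k})))))

  module Composite (n-composite : ¬ Prime n) where

    label : Fin n → ℕ
    label v with v ≟ ε
    ... | yes _ = 0
    ... | no _  = 2 + interleave ⌊ n /2⌋ (rank v)

    ordered-class-apart : ∀ {u v} → u ≢ ε → v ≢ ε → classRep u ≡ classRep v → toℕ u < toℕ v →
                          Apart 2 (interleave ⌊ n /2⌋ (rank u)) (interleave ⌊ n /2⌋ (rank v))
    ordered-class-apart {u} {v} u≢ε v≢ε repu≡repv u<v = interleave-apart ⌊ n /2⌋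
      (rank-< u≢ε (subst (λ r → toℕ (key u) < toℕ (combine r v)) repu≡repv (combine-monoʳ-< (classRep u) u<v)))
      (≤-trans (rank-close u≢ε v≢ε repu≡repv u<v)
               (+-monoʳ-≤ (rank u) (∸-monoˡ-≤ 2 (order≤⌊n/2⌋ n-composite u≢ε))))

    class-apart : ∀ {u v} → u ≢ ε → v ≢ ε → classRep u ≡ classRep v → u ≢ v →
                  Apart 2 (interleave ⌊ n /2⌋ (rank u)) (interleave ⌊ n /2⌋ (rank v))
    class-apart {u} {v} u≢ε v≢ε repu≡repv u≢v with <-cmp (toℕ u) (toℕ v)
    ... | tri< u<v _ _ = ordered-class-apart u≢ε v≢ε repu≡repv u<v
    ... | tri≈ _ u≡v _ = contradiction (toℕ-injective u≡v) u≢v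
    ... | tri> _ _ v<u = Apart-sym (ordered-class-apart v≢ε u≢ε (sym repu≡repv) v<u)

    label-injective : Injective _≡_ _≡_ label
    label-injective {u} {v} lu≡lv with u ≟ ε | v ≟ ε
    ... | yes u≡ε | yes v≡ε = trans u≡ε (sym v≡ε)
    ... | no u≢ε  | no v≢ε  =
      rank-injective u≢ε v≢ε (interleave-injective ⌊ n /2⌋ (suc-injective (suc-injective lu≡lv)))

    label-IsL21 : IsL21 G label
    label-IsL21 = adjacent-apart , λ u v (u≢v , _) → ≢⇒Apart (λ lu≡lv → u≢v (label-injective lu≡lv))
      where
      adjacent-apart : ∀ u v → Adj G u v → Apart 2 (label u) (label v)
      adjacent-apart u v (u≢v , u~v) with u ≟ ε | v ≟ ε
      ... | yes u≡ε | yes v≡ε = contradiction (trans u≡ε (sym v≡ε)) u≢v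
      ... | yes _   | no _    = inj₁ (s≤s (s≤s z≤n))
      ... | no _    | yes _   = inj₂ (s≤s (s≤s z≤n))
      ... | no u≢ε  | no v≢ε  = Apart-shift 2 (class-apart u≢ε v≢ε
              (Data.Sum.[ classRep-cong u≢ε v≢ε , sym ∘ classRep-cong v≢ε u≢ε ] u~v) u≢v)

    span-label : span G label ≤ n
    span-label = span≤ label bounded
      where
      bounded : ∀ v → label v ≤ n
      bounded v with v ≟ ε
      ... | yes _  = z≤n
      ... | no v≢ε = interleave-bound {⌊ n /2⌋} (2⌊n/2⌋≤n n) (n≤1+2⌊n/2⌋ n) (rank-bound v≢ε)

corollary3p5 : (n : ℕ) → (G : FinGroup n) → 1 < n
    → (∀ g → g ≢ FinGroup.ε G → HasPrimeOrder G g)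
    → (Prime n → LambdaIs G (2 * (n ∸ 1))) × (¬ Prime n → LambdaIs G n)
corollary3p5 n G 1<n prime-orders =
    (λ n-prime → LambdaIs-intro twiceIndex twiceIndex-IsL21 span-twiceIndex
                   (λ f f-L21 → span≥2[n-1] f f-L21 (complete n-prime)))
  , (λ n-composite → let open Composite n-composite in
       LambdaIs-intro label label-IsL21 span-label (λ f f-L21 → span≥n f f-L21 1<n))
  where
  open PowerGraph G
  open PrimeOrders G prime-orders
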